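{- In $ALFAo$, the rule $R_7$ is derivable using only $R_5$, $R_2$ and $R_8$ (together with transitivity): for all graphs $A,B$, $[AB]\vdash[A[[B]]]$ is derivable in the system whose rules are $R_2$, $R_5$ and $R_8$.
   Context: Graphs: the empty graph $\emptyset$ and propositional letters are graphs; if $G,H$ are graphs, so are their juxtaposition $GH$ and the cut $[G]$ ($G$ inside a solid closed curve). Juxtaposition is associative and commutative with unit $\emptyset$. Rules are schemata with $A,B,C$ arbitrary (possibly empty) graphs, applied to the whole graph on the sheet. $R_2: AB\vdash A$; $R_5: A[AB]\vdash A[B]$; $R_8$ (second degree): if $AB\vdash C$ is derivable then $A\vdash[B[C]]$ is derivable. Derivability in a system is the least transitive relation containing all instances of its first-degree rules and closed under its second-degree rules. -}

module Defs where

open import Data.Nat using (ℕ)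

-- Existential graphs (alpha part).  Letters are indexed by ℕ.
infixl 6 _·_
data Graph : Set where
  ∅    : Graph
  atom : ℕ → Graph
  _·_  : Graph → Graph → Graph
  cut  : Graph → Graph

-- Juxtaposition is associative, commutative with unit ∅; graphs are
-- identified up to the congruence generated by these laws.
infix 4 _≈_
data _≈_ : Graph → Graph → Set where
  ≈-refl  : ∀ {G} → G ≈ G
  ≈-sym   : ∀ {G H} → G ≈ H → H ≈ G
  ≈-trans : ∀ {G H K} → G ≈ H → H ≈ K → G ≈ K
  ≈-assoc : ∀ {G H K} → (G · H) · K ≈ G · (H · K)
  ≈-comm  : ∀ {G H} → G · H ≈ H · G
  ≈-unit  : ∀ {G} → G · ∅ ≈ G
  ≈-·     : ∀ {G G' H H'} → G ≈ G' → H ≈ H' → G · H ≈ G' · H'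
  ≈-cut   : ∀ {G H} → G ≈ H → cut G ≈ cut H

infix 3 _⊢_
data _⊢_ : Graph → Graph → Set where
  eqv   : ∀ {G H} → G ≈ H → G ⊢ H                 -- graphs are ≈-classes
  R₂    : ∀ A B → A · B ⊢ A
  R₅    : ∀ A B → A · cut (A · B) ⊢ A · cut B
  trans : ∀ {G H K} → G ⊢ H → H ⊢ K → G ⊢ K
  R₈    : ∀ {A B C} → A · B ⊢ C → A ⊢ cut (B · cut C)

module Submission where

open import Defs

-- By R₈ it suffices to derive [AB] · A ⊢ [B]: deiterate the A inside the cut
-- (R₅), then erase the outer A (R₂).

R₂ʳ : ∀ A B → A · B ⊢ B
R₂ʳ A B = trans (eqv ≈-comm) (R₂ B A)

cut-deiterate : ∀ A B → cut (A · B) · A ⊢ cut B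
cut-deiterate A B = trans (eqv ≈-comm) (trans (R₅ A B) (R₂ʳ A (cut B)))

mainTheorem2 : ∀ (A B : Graph) → cut (A · B) ⊢ cut (A · cut (cut B))
mainTheorem2 A B = R₈ (cut-deiterate A B)
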